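{- Let $n\ge m\ge\ell\ge1$ be integers. Then \[\binom{m}{\ell}-\sum_{\ell_1=0}^{\ell}\binom{m-i}{\ell_1}\binom{n-i}{\ell_1}\binom{i}{\ell-\ell_1}(-1)^{\ell_1}\ne0\quad\text{for all } i=0,1,\dots,m-1\] if and only if \[\sum_{t=1}^{j}(-1)^{t-1}\binom{m-t}{m-\ell}\binom{j}{t}\binom{n-m+j+t}{t}\ne0\quad\text{for all } j=1,\dots,m.\]
   Context: Binomial coefficients $\binom{a}{b}$ with $0\le a<b$ are $0$. -}

module Defs where

open import Data.Nat using (ℕ; zero; suc; _∸_)
import Data.Nat
open import Data.Nat.Combinatorics using (_C_)
open import Data.Integer using (ℤ; +_; -_; _+_; _*_)

sumUpTo : ℕ → (ℕ → ℤ) → ℤ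
sumUpTo zero    f = f zero
sumUpTo (suc b) f = sumUpTo b f + f (suc b)

sumOneTo : ℕ → (ℕ → ℤ) → ℤ
sumOneTo zero    f = + 0
sumOneTo (suc b) f = sumOneTo b f + f (suc b)

sign : ℕ → ℤ
sign zero    = + 1
sign (suc k) = - sign k

-- binomial coefficient as an integer (stdlib's _C_, which is 0 when k > n)
binom : ℕ → ℕ → ℤ
binom a b = + (a C b)

A : ℕ → ℕ → ℕ → ℕ → ℤ
A n m ℓ i = binom m ℓ + - sumUpTo ℓ (λ l₁ →
  binom (m ∸ i) l₁ * binom (n ∸ i) l₁ * binom i (ℓ ∸ l₁) * sign l₁)

B : ℕ → ℕ → ℕ → ℕ → ℤ
B n m ℓ j = sumOneTo j (λ t →
  sign (t ∸ 1) * binom (m ∸ t) (m ∸ ℓ) * binom j t * binom (n ∸ m Data.Nat.+ j Data.Nat.+ t) t)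

-- Put j = m − i and M = n − i (so M = n − m + j), and consider
--   F(z) = Σ_t (−1)^t C(j,t) C(M,t) z^t = Σ_t (−1)^t C(j,t) C(M+t,t) z^t (1 + z)^(j−t).
-- The two expansions agree coefficientwise: by C(j,t) C(j−t,ℓ−t) = C(j,ℓ) C(ℓ,t), the coefficient
-- of z^ℓ in the second is C(j,ℓ) Σ_t (−1)^t C(ℓ,t) C(M+t,t) = (−1)^ℓ C(j,ℓ) C(M,ℓ).
-- The coefficient of z^ℓ in (1 + z)^i F(z), read off the first expansion, is the sum in A(i);
-- read off the second, it is C(m,ℓ) (the term t = 0) minus B(j). Hence A(m − j) = B(j) for
-- every j ≤ m, and the two conditions coincide under i = m − j.
-- The factor (1 + z)^i is handled through Pascal's rule: both coefficient arrays satisfy it in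
-- (i, ℓ), so agreeing at i = 0 they agree for all i.

module Submission where

open import Defs
open import Data.Nat as ℕ using (ℕ; zero; suc; _≤_; _<_; z≤n; _∸_; _!; _≤′_; ≤′-refl; ≤′-step)
import Data.Nat.Properties as ℕ
open import Data.Nat.Combinatorics
  using (_C_; nCk+nC[k+1]≡[n+1]C[k+1]; k>n⇒nCk≡0; nCk≡nC[n∸k]; nCk≡n!/k![n-k]!; k![n∸k]!∣n!)
open import Data.Nat.DivMod using (m/n*n≡m)
import Data.Nat.Tactic.RingSolver as ℕ-Ring
import Data.Integer.Properties as ℤ
open import Data.Integer.Tactic.RingSolver using (solve-∀)
open import Algebra.Properties.CommutativeSemigroup ℤ.+-commutativeSemigroup using (interchange)
open import Data.Product using (_×_; _,_)
open import Function.Bundles using (_⇔_; mk⇔)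
open import Relation.Nullary using (¬_; yes; no)
open import Data.Empty using (⊥-elim)
open import Relation.Binary.PropositionalEquality
  using (_≡_; _≢_; refl; sym; trans; cong; cong₂; module ≡-Reasoning)

open ≡-Reasoning

module _ where
  open import Data.Nat using (_+_; _*_; _/_)

  [m∸o]∸[n∸o]≡m∸n : ∀ m {n o} → o ≤ n → (m ∸ o) ∸ (n ∸ o) ≡ m ∸ n
  [m∸o]∸[n∸o]≡m∸n m {n} {o} o≤n = trans (ℕ.∸-+-assoc m o (n ∸ o)) (cong (m ∸_) (ℕ.m+[n∸m]≡n o≤n))

  m∸[n∸o]≡m∸n+o : ∀ {m n o} → n ≤ m → o ≤ n → m ∸ (n ∸ o) ≡ m ∸ n + o
  m∸[n∸o]≡m∸n+o {m} {n} {o} n≤m o≤n = begin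
    m ∸ (n ∸ o)             ≡⟨ cong (_∸ (n ∸ o)) (ℕ.m∸n+n≡m n≤m) ⟨
    m ∸ n + n ∸ (n ∸ o)     ≡⟨ ℕ.+-∸-assoc (m ∸ n) (ℕ.m∸n≤m n o) ⟩
    m ∸ n + (n ∸ (n ∸ o))   ≡⟨ cong (m ∸ n +_) (ℕ.m∸[m∸n]≡n o≤n) ⟩
    m ∸ n + o               ∎

  C*factorials≡factorial : ∀ {n k} → k ≤ n → (n C k) * (k ! * (n ∸ k) !) ≡ n !
  C*factorials≡factorial {n} {k} k≤n = begin
    (n C k) * (k ! * (n ∸ k) !)                 ≡⟨ cong (_* (k ! * (n ∸ k) !)) (nCk≡n!/k![n-k]! k≤n) ⟩
    n ! / (k ! * (n ∸ k) !) * (k ! * (n ∸ k) !) ≡⟨ m/n*n≡m (k![n∸k]!∣n! k≤n) ⟩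
    n !                                         ∎
    where instance _ = ℕ._!*_!≢0 k (n ∸ k)

  -- Both sides times t! (ℓ - t)! (j - ℓ)! equal j!.
  C-trinomial : ∀ {j ℓ t} → t ≤ ℓ → ℓ ≤ j → (j C t) * ((j ∸ t) C (ℓ ∸ t)) ≡ (j C ℓ) * (ℓ C t)
  C-trinomial {j} {ℓ} {t} t≤ℓ ℓ≤j = ℕ.*-cancelʳ-≡ _ _ (t ! * (ℓ ∸ t) ! * (j ∸ ℓ) !) (trans lhs (sym rhs))
    where
    instance _ = ℕ.m*n≢0 (t ! * (ℓ ∸ t) !) ((j ∸ ℓ) !) {{ℕ._!*_!≢0 t (ℓ ∸ t)}} {{ℕ._!≢0 (j ∸ ℓ)}}
    t≤j = ℕ.≤-trans t≤ℓ ℓ≤j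
    regroup : ∀ a b u v w → a * b * (u * v * w) ≡ a * (u * (b * (v * w)))
    regroup = ℕ-Ring.solve-∀
    regroup′ : ∀ a b u v w → a * b * (u * v * w) ≡ a * (b * (u * v) * w)
    regroup′ = ℕ-Ring.solve-∀
    lhs : (j C t) * ((j ∸ t) C (ℓ ∸ t)) * (t ! * (ℓ ∸ t) ! * (j ∸ ℓ) !) ≡ j !
    lhs = begin
      (j C t) * ((j ∸ t) C (ℓ ∸ t)) * (t ! * (ℓ ∸ t) ! * (j ∸ ℓ) !)
        ≡⟨ regroup (j C t) ((j ∸ t) C (ℓ ∸ t)) (t !) ((ℓ ∸ t) !) ((j ∸ ℓ) !) ⟩
      (j C t) * (t ! * (((j ∸ t) C (ℓ ∸ t)) * ((ℓ ∸ t) ! * (j ∸ ℓ) !)))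
        ≡⟨ cong (λ x → (j C t) * (t ! * (((j ∸ t) C (ℓ ∸ t)) * ((ℓ ∸ t) ! * x !))))
                (sym ([m∸o]∸[n∸o]≡m∸n j t≤ℓ)) ⟩
      (j C t) * (t ! * (((j ∸ t) C (ℓ ∸ t)) * ((ℓ ∸ t) ! * ((j ∸ t) ∸ (ℓ ∸ t)) !)))
        ≡⟨ cong (λ x → (j C t) * (t ! * x)) (C*factorials≡factorial (ℕ.∸-monoˡ-≤ t ℓ≤j)) ⟩
      (j C t) * (t ! * (j ∸ t) !)
        ≡⟨ C*factorials≡factorial t≤j ⟩
      j ! ∎
    rhs : (j C ℓ) * (ℓ C t) * (t ! * (ℓ ∸ t) ! * (j ∸ ℓ) !) ≡ j !
    rhs = begin
      (j C ℓ) * (ℓ C t) * (t ! * (ℓ ∸ t) ! * (j ∸ ℓ) !)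
        ≡⟨ regroup′ (j C ℓ) (ℓ C t) (t !) ((ℓ ∸ t) !) ((j ∸ ℓ) !) ⟩
      (j C ℓ) * ((ℓ C t) * (t ! * (ℓ ∸ t) !) * (j ∸ ℓ) !)
        ≡⟨ cong (λ x → (j C ℓ) * (x * (j ∸ ℓ) !)) (C*factorials≡factorial t≤ℓ) ⟩
      (j C ℓ) * (ℓ ! * (j ∸ ℓ) !)
        ≡⟨ C*factorials≡factorial ℓ≤j ⟩
      j ! ∎

  -- shiftC x t ℓ is the coefficient of z^ℓ in z^t (1 + z)^x.
  shiftC : ℕ → ℕ → ℕ → ℕ
  shiftC x zero    ℓ       = x C ℓ
  shiftC x (suc t) zero    = 0
  shiftC x (suc t) (suc ℓ) = shiftC x t ℓ

  shiftC-pascal : ∀ x t ℓ → shiftC (suc x) t ℓ ≡ shiftC x t ℓ + shiftC x (suc t) ℓ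
  shiftC-pascal x zero    zero    = refl
  shiftC-pascal x zero    (suc ℓ) = trans (sym (nCk+nC[k+1]≡[n+1]C[k+1] x ℓ)) (ℕ.+-comm (x C ℓ) _)
  shiftC-pascal x (suc t) zero    = refl
  shiftC-pascal x (suc t) (suc ℓ) = shiftC-pascal x t ℓ

  shiftC-≤ : ∀ x {t ℓ} → t ≤ ℓ → shiftC x t ℓ ≡ x C (ℓ ∸ t)
  shiftC-≤ x {zero}          _         = refl
  shiftC-≤ x {suc t} {suc ℓ} (ℕ.s≤s t≤ℓ) = shiftC-≤ x t≤ℓ

  shiftC-> : ∀ x {t ℓ} → ℓ < t → shiftC x t ℓ ≡ 0
  shiftC-> x {suc t} {zero}  _           = refl
  shiftC-> x {suc t} {suc ℓ} (ℕ.s≤s ℓ<t) = shiftC-> x ℓ<t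

  shiftC-0-self : ∀ ℓ → shiftC 0 ℓ ℓ ≡ 1
  shiftC-0-self zero    = refl
  shiftC-0-self (suc ℓ) = shiftC-0-self ℓ

  shiftC-0-≢ : ∀ {t ℓ} → t ≢ ℓ → shiftC 0 t ℓ ≡ 0
  shiftC-0-≢ {zero}  {zero}  t≢ℓ = ⊥-elim (t≢ℓ refl)
  shiftC-0-≢ {zero}  {suc ℓ} _   = refl
  shiftC-0-≢ {suc t} {zero}  _   = refl
  shiftC-0-≢ {suc t} {suc ℓ} t≢ℓ = shiftC-0-≢ (λ t≡ℓ → t≢ℓ (cong suc t≡ℓ))

  C*shiftC≡C*C : ∀ {j t} ℓ → t ≤ j → (j C t) * shiftC (j ∸ t) t ℓ ≡ (j C ℓ) * (ℓ C t)
  C*shiftC≡C*C {j} {t} ℓ t≤j with ℓ ℕ.<? t | ℓ ℕ.≤? j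
  ... | yes ℓ<t | _ = begin
    (j C t) * shiftC (j ∸ t) t ℓ ≡⟨ cong ((j C t) *_) (shiftC-> (j ∸ t) ℓ<t) ⟩
    (j C t) * 0                  ≡⟨ ℕ.*-zeroʳ (j C t) ⟩
    0                            ≡⟨ ℕ.*-zeroʳ (j C ℓ) ⟨
    (j C ℓ) * 0                  ≡⟨ cong ((j C ℓ) *_) (k>n⇒nCk≡0 ℓ<t) ⟨
    (j C ℓ) * (ℓ C t)            ∎
  ... | no ℓ≮t | yes ℓ≤j = trans (cong ((j C t) *_) (shiftC-≤ (j ∸ t) t≤ℓ)) (C-trinomial t≤ℓ ℓ≤j)
    where t≤ℓ = ℕ.≮⇒≥ ℓ≮t
  ... | no ℓ≮t | no ℓ≰j = begin
    (j C t) * shiftC (j ∸ t) t ℓ       ≡⟨ cong ((j C t) *_) (shiftC-≤ (j ∸ t) (ℕ.≮⇒≥ ℓ≮t)) ⟩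
    (j C t) * ((j ∸ t) C (ℓ ∸ t))      ≡⟨ cong ((j C t) *_) (k>n⇒nCk≡0 (ℕ.∸-monoˡ-< (ℕ.≰⇒> ℓ≰j) t≤j)) ⟩
    (j C t) * 0                        ≡⟨ ℕ.*-zeroʳ (j C t) ⟩
    0                                  ≡⟨ cong (_* (ℓ C t)) (k>n⇒nCk≡0 (ℕ.≰⇒> ℓ≰j)) ⟨
    (j C ℓ) * (ℓ C t)                  ∎

  shiftC-complement : ∀ {m t ℓ} → t ≤ m → ℓ ≤ m → shiftC (m ∸ t) t ℓ ≡ (m ∸ t) C (m ∸ ℓ)
  shiftC-complement {m} {t} {ℓ} t≤m ℓ≤m with t ℕ.≤? ℓ
  ... | yes t≤ℓ = begin
    shiftC (m ∸ t) t ℓ                  ≡⟨ shiftC-≤ (m ∸ t) t≤ℓ ⟩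
    (m ∸ t) C (ℓ ∸ t)                   ≡⟨ nCk≡nC[n∸k] (ℕ.∸-monoˡ-≤ t ℓ≤m) ⟩
    (m ∸ t) C ((m ∸ t) ∸ (ℓ ∸ t))       ≡⟨ cong ((m ∸ t) C_) ([m∸o]∸[n∸o]≡m∸n m t≤ℓ) ⟩
    (m ∸ t) C (m ∸ ℓ)                   ∎
  ... | no t≰ℓ = trans (shiftC-> (m ∸ t) ℓ<t) (sym (k>n⇒nCk≡0 (ℕ.∸-monoʳ-< ℓ<t t≤m)))
    where ℓ<t = ℕ.≰⇒> t≰ℓ

open import Data.Integer using (ℤ; +_; -_; _+_; _-_; _*_)

sumUpTo-cong : ∀ b {f g : ℕ → ℤ} → (∀ k → k ≤ b → f k ≡ g k) → sumUpTo b f ≡ sumUpTo b g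
sumUpTo-cong zero    f≗g = f≗g 0 z≤n
sumUpTo-cong (suc b) f≗g =
  cong₂ _+_ (sumUpTo-cong b (λ k k≤b → f≗g k (ℕ.m≤n⇒m≤1+n k≤b))) (f≗g (suc b) ℕ.≤-refl)

sumUpTo-+ : ∀ b (f g : ℕ → ℤ) → sumUpTo b (λ k → f k + g k) ≡ sumUpTo b f + sumUpTo b g
sumUpTo-+ zero    f g = refl
sumUpTo-+ (suc b) f g = trans (cong (_+ (f (suc b) + g (suc b))) (sumUpTo-+ b f g))
                              (interchange (sumUpTo b f) (sumUpTo b g) (f (suc b)) (g (suc b)))

sumUpTo-neg : ∀ b (f : ℕ → ℤ) → sumUpTo b (λ k → - f k) ≡ - sumUpTo b f
sumUpTo-neg zero    f = refl
sumUpTo-neg (suc b) f = trans (cong (_- f (suc b)) (sumUpTo-neg b f))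
                              (sym (ℤ.neg-distrib-+ (sumUpTo b f) (f (suc b))))

sumUpTo-- : ∀ b (f g : ℕ → ℤ) → sumUpTo b (λ k → f k - g k) ≡ sumUpTo b f - sumUpTo b g
sumUpTo-- b f g = trans (sumUpTo-+ b f (λ k → - g k)) (cong (_+_ (sumUpTo b f)) (sumUpTo-neg b g))

sumUpTo-*ˡ : ∀ b c (f : ℕ → ℤ) → sumUpTo b (λ k → c * f k) ≡ c * sumUpTo b f
sumUpTo-*ˡ zero    c f = refl
sumUpTo-*ˡ (suc b) c f = trans (cong (_+ c * f (suc b)) (sumUpTo-*ˡ b c f))
                               (sym (ℤ.*-distribˡ-+ c (sumUpTo b f) (f (suc b))))

sumUpTo-zero : ∀ b (f : ℕ → ℤ) → (∀ k → k ≤ b → f k ≡ + 0) → sumUpTo b f ≡ + 0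
sumUpTo-zero b f f≗0 = trans (sumUpTo-cong b f≗0) (zeros b)
  where
  zeros : ∀ b → sumUpTo b (λ _ → + 0) ≡ + 0
  zeros zero    = refl
  zeros (suc b) = cong (_+ + 0) (zeros b)

sumUpTo-extend : ∀ {b c} (f : ℕ → ℤ) → b ≤ c → (∀ k → b < k → k ≤ c → f k ≡ + 0) →
                 sumUpTo c f ≡ sumUpTo b f
sumUpTo-extend {b} f b≤c vanish = go (ℕ.≤⇒≤′ b≤c) vanish
  where
  go : ∀ {c} → b ≤′ c → (∀ k → b < k → k ≤ c → f k ≡ + 0) → sumUpTo c f ≡ sumUpTo b f
  go ≤′-refl              _      = refl
  go (≤′-step {c} b≤′c) vanish = begin
    sumUpTo c f + f (suc c) ≡⟨ cong₂ _+_ (go b≤′c (λ k b<k k≤c → vanish k b<k (ℕ.m≤n⇒m≤1+n k≤c)))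
                                         (vanish (suc c) (ℕ.s≤s (ℕ.≤′⇒≤ b≤′c)) ℕ.≤-refl) ⟩
    sumUpTo b f + + 0       ≡⟨ ℤ.+-identityʳ _ ⟩
    sumUpTo b f             ∎

sumUpTo-single : ∀ {a b} (f : ℕ → ℤ) → a ≤ b → (∀ k → k ≤ b → k ≢ a → f k ≡ + 0) →
                 sumUpTo b f ≡ f a
sumUpTo-single {a} {b} f a≤b vanish = begin
  sumUpTo b f ≡⟨ sumUpTo-extend f a≤b (λ k a<k k≤b → vanish k k≤b (ℕ.>⇒≢ a<k)) ⟩
  sumUpTo a f ≡⟨ below a (λ k k<a → vanish k (ℕ.<⇒≤ (ℕ.<-≤-trans k<a a≤b)) (ℕ.<⇒≢ k<a)) ⟩
  f a         ∎
  where
  below : ∀ a → (∀ k → k < a → f k ≡ + 0) → sumUpTo a f ≡ f a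
  below zero    _      = refl
  below (suc a) vanish = begin
    sumUpTo a f + f (suc a) ≡⟨ cong (_+ f (suc a)) (sumUpTo-zero a f (λ k k≤a → vanish k (ℕ.s≤s k≤a))) ⟩
    + 0 + f (suc a)         ≡⟨ ℤ.+-identityˡ _ ⟩
    f (suc a)               ∎

sumUpTo-head : ∀ b (f : ℕ → ℤ) → sumUpTo (suc b) f ≡ f 0 + sumUpTo b (λ k → f (suc k))
sumUpTo-head zero    f = refl
sumUpTo-head (suc b) f = trans (cong (_+ f (suc (suc b))) (sumUpTo-head b f)) (ℤ.+-assoc (f 0) _ _)

sumUpTo≡head+sumOneTo : ∀ b (f : ℕ → ℤ) → sumUpTo b f ≡ f 0 + sumOneTo b f
sumUpTo≡head+sumOneTo zero    f = sym (ℤ.+-identityʳ _)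
sumUpTo≡head+sumOneTo (suc b) f =
  trans (cong (_+ f (suc b)) (sumUpTo≡head+sumOneTo b f)) (ℤ.+-assoc (f 0) _ _)

sumOneTo-cong : ∀ b {f g : ℕ → ℤ} → (∀ k → k < b → f (suc k) ≡ g (suc k)) →
                sumOneTo b f ≡ sumOneTo b g
sumOneTo-cong zero    _   = refl
sumOneTo-cong (suc b) f≗g =
  cong₂ _+_ (sumOneTo-cong b (λ k k<b → f≗g k (ℕ.m<n⇒m<1+n k<b))) (f≗g b ℕ.≤-refl)

sumOneTo-neg : ∀ b (f : ℕ → ℤ) → sumOneTo b (λ k → - f k) ≡ - sumOneTo b f
sumOneTo-neg zero    f = refl
sumOneTo-neg (suc b) f = trans (cong (_- f (suc b)) (sumOneTo-neg b f))
                               (sym (ℤ.neg-distrib-+ (sumOneTo b f) (f (suc b))))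

*-zero-middle : ∀ x y {n} → n ≡ 0 → x * + n * y ≡ + 0
*-zero-middle x y refl = cong (_* y) (ℤ.*-zeroʳ x)

altSum : ℕ → (ℕ → ℤ) → ℤ
altSum ℓ f = sumUpTo ℓ (λ t → sign t * + (ℓ C t) * f t)

altSum-cong : ∀ ℓ {f g : ℕ → ℤ} → (∀ t → f t ≡ g t) → altSum ℓ f ≡ altSum ℓ g
altSum-cong ℓ f≗g = sumUpTo-cong ℓ (λ t _ → cong (λ x → sign t * + (ℓ C t) * x) (f≗g t))

altSum-+ : ∀ ℓ (f g : ℕ → ℤ) → altSum ℓ (λ t → f t + g t) ≡ altSum ℓ f + altSum ℓ g
altSum-+ ℓ f g = trans (sumUpTo-cong ℓ (λ t _ → ℤ.*-distribˡ-+ (sign t * + (ℓ C t)) (f t) (g t)))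
                       (sumUpTo-+ ℓ _ _)

altSum-suc : ∀ ℓ (f : ℕ → ℤ) → altSum (suc ℓ) f ≡ altSum ℓ f - altSum ℓ (λ t → f (suc t))
altSum-suc ℓ f = begin
  altSum (suc ℓ) f
    ≡⟨ sumUpTo-head ℓ g ⟩
  h 0 + sumUpTo ℓ (λ t → g (suc t))
    ≡⟨ cong (_+_ (h 0)) (sumUpTo-cong ℓ (λ t _ → g-pascal t)) ⟩
  h 0 + sumUpTo ℓ (λ t → h (suc t) - h′ t)
    ≡⟨ cong (_+_ (h 0)) (sumUpTo-- ℓ (λ t → h (suc t)) h′) ⟩
  h 0 + (sumUpTo ℓ (λ t → h (suc t)) - altSum ℓ f′)
    ≡⟨ ℤ.+-assoc (h 0) _ _ ⟨
  h 0 + sumUpTo ℓ (λ t → h (suc t)) - altSum ℓ f′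
    ≡⟨ cong (_- altSum ℓ f′) (sumUpTo-head ℓ h) ⟨
  altSum ℓ f + h (suc ℓ) - altSum ℓ f′
    ≡⟨ cong (λ x → altSum ℓ f + x - altSum ℓ f′) h-top ⟩
  altSum ℓ f + + 0 - altSum ℓ f′
    ≡⟨ cong (_- altSum ℓ f′) (ℤ.+-identityʳ (altSum ℓ f)) ⟩
  altSum ℓ f - altSum ℓ f′
    ∎
  where
  f′ g h h′ : ℕ → ℤ
  f′ t = f (suc t)
  g  t = sign t * + (suc ℓ C t) * f t
  h  t = sign t * + (ℓ C t) * f t
  h′ t = sign t * + (ℓ C t) * f (suc t)
  split : ∀ s a b x → - s * (a + b) * x ≡ - s * b * x - s * a * x
  split = solve-∀
  g-pascal : ∀ t → g (suc t) ≡ h (suc t) - h′ t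
  g-pascal t = trans (cong (λ x → - sign t * x * f (suc t))
                           (trans (cong +_ (sym (nCk+nC[k+1]≡[n+1]C[k+1] ℓ t))) (ℤ.pos-+ (ℓ C t) _)))
                     (split (sign t) (+ (ℓ C t)) (+ (ℓ C suc t)) (f (suc t)))
  h-top : h (suc ℓ) ≡ + 0
  h-top = *-zero-middle (sign (suc ℓ)) (f (suc ℓ)) (k>n⇒nCk≡0 (ℕ.n<1+n ℓ))

-- Induction on ℓ with K generalised: by Pascal's rule, f K (t + 1) − f K t = f (K + 1) t.
altSum-C : ∀ ℓ M K → altSum ℓ (λ t → + ((M ℕ.+ t) C (K ℕ.+ t))) ≡ sign ℓ * + (M C (K ℕ.+ ℓ))
altSum-C zero    M K = begin
  + 1 * + ((M ℕ.+ 0) C (K ℕ.+ 0)) ≡⟨ ℤ.*-identityˡ _ ⟩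
  + ((M ℕ.+ 0) C (K ℕ.+ 0))       ≡⟨ cong (λ a → + (a C (K ℕ.+ 0))) (ℕ.+-identityʳ M) ⟩
  + (M C (K ℕ.+ 0))               ≡⟨ ℤ.*-identityˡ _ ⟨
  + 1 * + (M C (K ℕ.+ 0))         ∎
altSum-C (suc ℓ) M K = begin
  altSum (suc ℓ) (f K)
    ≡⟨ altSum-suc ℓ (f K) ⟩
  altSum ℓ (f K) - altSum ℓ (λ t → f K (suc t))
    ≡⟨ cong (_-_ (altSum ℓ (f K))) shifted ⟩
  altSum ℓ (f K) - (altSum ℓ (f K) + altSum ℓ (f (suc K)))
    ≡⟨ x-[x+y]≡-y (altSum ℓ (f K)) _ ⟩
  - altSum ℓ (f (suc K))
    ≡⟨ cong -_ (altSum-C ℓ M (suc K)) ⟩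
  - (sign ℓ * + (M C (suc K ℕ.+ ℓ)))
    ≡⟨ ℤ.neg-distribˡ-* (sign ℓ) _ ⟩
  sign (suc ℓ) * + (M C suc (K ℕ.+ ℓ))
    ≡⟨ cong (λ k → sign (suc ℓ) * + (M C k)) (ℕ.+-suc K ℓ) ⟨
  sign (suc ℓ) * + (M C (K ℕ.+ suc ℓ))
    ∎
  where
  f : ℕ → ℕ → ℤ
  f k t = + ((M ℕ.+ t) C (k ℕ.+ t))
  x-[x+y]≡-y : ∀ x y → x - (x + y) ≡ - y
  x-[x+y]≡-y = solve-∀
  f-pascal : ∀ t → f K (suc t) ≡ f K t + f (suc K) t
  f-pascal t = begin
    + ((M ℕ.+ suc t) C (K ℕ.+ suc t))         ≡⟨ cong₂ (λ a b → + (a C b)) (ℕ.+-suc M t) (ℕ.+-suc K t) ⟩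
    + (suc (M ℕ.+ t) C suc (K ℕ.+ t))         ≡⟨ cong +_ (nCk+nC[k+1]≡[n+1]C[k+1] (M ℕ.+ t) (K ℕ.+ t)) ⟨
    + ((M ℕ.+ t) C (K ℕ.+ t) ℕ.+ (M ℕ.+ t) C suc (K ℕ.+ t)) ≡⟨ ℤ.pos-+ ((M ℕ.+ t) C (K ℕ.+ t)) _ ⟩
    f K t + f (suc K) t                       ∎
  shifted : altSum ℓ (λ t → f K (suc t)) ≡ altSum ℓ (f K) + altSum ℓ (f (suc K))
  shifted = trans (altSum-cong ℓ f-pascal) (altSum-+ ℓ (f K) (f (suc K)))

IsPascal : (ℕ → ℕ → ℤ) → Set
IsPascal F = (∀ p → F (suc p) 0 ≡ F p 0) × (∀ p ℓ → F (suc p) (suc ℓ) ≡ F p (suc ℓ) + F p ℓ)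

pascal-unique : ∀ {F G} → IsPascal F → IsPascal G → (∀ ℓ → F 0 ℓ ≡ G 0 ℓ) → ∀ p ℓ → F p ℓ ≡ G p ℓ
pascal-unique {F} {G} (F-zero , F-suc) (G-zero , G-suc) F₀≗G₀ = go
  where
  go : ∀ p ℓ → F p ℓ ≡ G p ℓ
  go zero    ℓ       = F₀≗G₀ ℓ
  go (suc p) zero    = begin
    F (suc p) 0 ≡⟨ F-zero p ⟩
    F p 0       ≡⟨ go p 0 ⟩
    G p 0       ≡⟨ G-zero p ⟨
    G (suc p) 0 ∎
  go (suc p) (suc ℓ) = begin
    F (suc p) (suc ℓ)     ≡⟨ F-suc p ℓ ⟩
    F p (suc ℓ) + F p ℓ   ≡⟨ cong₂ _+_ (go p (suc ℓ)) (go p ℓ) ⟩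
    G p (suc ℓ) + G p ℓ   ≡⟨ G-suc p ℓ ⟨
    G (suc p) (suc ℓ)     ∎

-- coeff J c e p ℓ is the coefficient of z^ℓ in (1 + z)^p Σ_{t ≤ J} c t z^t (1 + z)^(e t).
coeff : ℕ → (ℕ → ℤ) → (ℕ → ℕ) → ℕ → ℕ → ℤ
coeff J c e p ℓ = sumUpTo J (λ t → c t * + shiftC (p ℕ.+ e t) t ℓ)

coeff-isPascal : ∀ J c e → IsPascal (coeff J c e)
coeff-isPascal J c e = at-zero , at-suc
  where
  at-zero : ∀ p → coeff J c e (suc p) 0 ≡ coeff J c e p 0
  at-zero p = sumUpTo-cong J (λ t _ →
    cong (λ x → c t * + x) (trans (shiftC-pascal (p ℕ.+ e t) t 0) (ℕ.+-identityʳ _)))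
  at-suc : ∀ p ℓ → coeff J c e (suc p) (suc ℓ) ≡ coeff J c e p (suc ℓ) + coeff J c e p ℓ
  at-suc p ℓ = trans (sumUpTo-cong J (λ t _ → begin
      c t * + shiftC (suc p ℕ.+ e t) t (suc ℓ)
        ≡⟨ cong (λ x → c t * + x) (shiftC-pascal (p ℕ.+ e t) t (suc ℓ)) ⟩
      c t * + (shiftC (p ℕ.+ e t) t (suc ℓ) ℕ.+ shiftC (p ℕ.+ e t) t ℓ)
        ≡⟨ cong (c t *_) (ℤ.pos-+ (shiftC (p ℕ.+ e t) t (suc ℓ)) _) ⟩
      c t * (+ shiftC (p ℕ.+ e t) t (suc ℓ) + + shiftC (p ℕ.+ e t) t ℓ)
        ≡⟨ ℤ.*-distribˡ-+ (c t) _ _ ⟩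
      c t * + shiftC (p ℕ.+ e t) t (suc ℓ) + c t * + shiftC (p ℕ.+ e t) t ℓ ∎))
    (sumUpTo-+ J _ _)

sumUpTo-*shiftC-0 : ∀ J ℓ (f : ℕ → ℤ) → (∀ t → J < t → f t ≡ + 0) →
                    sumUpTo J (λ t → f t * + shiftC 0 t ℓ) ≡ f ℓ
sumUpTo-*shiftC-0 J ℓ f vanish = begin
  sumUpTo J g          ≡⟨ sumUpTo-extend g (ℕ.m≤m+n J ℓ) beyond-J ⟨
  sumUpTo (J ℕ.+ ℓ) g  ≡⟨ sumUpTo-single g (ℕ.m≤n+m ℓ J) off-diagonal ⟩
  f ℓ * + shiftC 0 ℓ ℓ ≡⟨ cong (λ x → f ℓ * + x) (shiftC-0-self ℓ) ⟩
  f ℓ * + 1            ≡⟨ ℤ.*-identityʳ (f ℓ) ⟩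
  f ℓ                  ∎
  where
  g : ℕ → ℤ
  g t = f t * + shiftC 0 t ℓ
  beyond-J : ∀ t → J < t → t ≤ J ℕ.+ ℓ → g t ≡ + 0
  beyond-J t J<t _ = cong (_* + shiftC 0 t ℓ) (vanish t J<t)
  off-diagonal : ∀ t → t ≤ J ℕ.+ ℓ → t ≢ ℓ → g t ≡ + 0
  off-diagonal t _ t≢ℓ = trans (cong (λ x → f t * + x) (shiftC-0-≢ t≢ℓ)) (ℤ.*-zeroʳ (f t))

module _ (j M : ℕ) where

  -- The coefficients of the two expansions of F: Σ_t cL t z^t and Σ_t cR t z^t (1 + z)^(j − t).
  private
    cL cR : ℕ → ℤ
    cL t = sign t * + (j C t) * + (M C t)
    cR t = sign t * + (j C t) * + ((M ℕ.+ t) C t)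

    cL-vanish : ∀ t → j < t → cL t ≡ + 0
    cL-vanish t j<t = *-zero-middle (sign t) (+ (M C t)) (k>n⇒nCk≡0 j<t)

    base-left : ∀ ℓ → coeff j cL (λ _ → 0) 0 ℓ ≡ cL ℓ
    base-left ℓ = sumUpTo-*shiftC-0 j ℓ cL cL-vanish

    altTerm : ℕ → ℕ → ℤ
    altTerm ℓ t = sign t * + (ℓ C t) * + ((M ℕ.+ t) C t)

    cR*shiftC≡C*altTerm : ∀ ℓ t → t ≤ j → cR t * + shiftC (j ∸ t) t ℓ ≡ + (j C ℓ) * altTerm ℓ t
    cR*shiftC≡C*altTerm ℓ t t≤j = begin
      cR t * + shiftC (j ∸ t) t ℓ
        ≡⟨ regroup (sign t) (+ (j C t)) (+ ((M ℕ.+ t) C t)) (+ shiftC (j ∸ t) t ℓ) ⟩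
      sign t * + ((M ℕ.+ t) C t) * (+ (j C t) * + shiftC (j ∸ t) t ℓ)
        ≡⟨ cong (λ x → sign t * + ((M ℕ.+ t) C t) * x) (begin
             + (j C t) * + shiftC (j ∸ t) t ℓ   ≡⟨ ℤ.pos-* (j C t) _ ⟨
             + ((j C t) ℕ.* shiftC (j ∸ t) t ℓ) ≡⟨ cong +_ (C*shiftC≡C*C ℓ t≤j) ⟩
             + ((j C ℓ) ℕ.* (ℓ C t))            ≡⟨ ℤ.pos-* (j C ℓ) (ℓ C t) ⟩
             + (j C ℓ) * + (ℓ C t)              ∎) ⟩
      sign t * + ((M ℕ.+ t) C t) * (+ (j C ℓ) * + (ℓ C t))
        ≡⟨ regroup′ (sign t) (+ ((M ℕ.+ t) C t)) (+ (j C ℓ)) (+ (ℓ C t)) ⟩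
      + (j C ℓ) * altTerm ℓ t ∎
      where
      regroup : ∀ s a b x → s * a * b * x ≡ s * b * (a * x)
      regroup = solve-∀
      regroup′ : ∀ s b c d → s * b * (c * d) ≡ c * (s * d * b)
      regroup′ = solve-∀

    C*sum-altTerm≡cL : ∀ ℓ → + (j C ℓ) * sumUpTo j (altTerm ℓ) ≡ cL ℓ
    C*sum-altTerm≡cL ℓ with ℓ ℕ.≤? j
    ... | yes ℓ≤j = begin
      + (j C ℓ) * sumUpTo j (altTerm ℓ)  ≡⟨ cong (_*_ (+ (j C ℓ))) (sumUpTo-extend (altTerm ℓ) ℓ≤j
                                              (λ t ℓ<t _ → *-zero-middle (sign t) _ (k>n⇒nCk≡0 ℓ<t))) ⟩
      + (j C ℓ) * altSum ℓ (λ t → + ((M ℕ.+ t) C (0 ℕ.+ t)))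
                                          ≡⟨ cong (_*_ (+ (j C ℓ))) (altSum-C ℓ M 0) ⟩
      + (j C ℓ) * (sign ℓ * + (M C ℓ))   ≡⟨ swap (+ (j C ℓ)) (sign ℓ) (+ (M C ℓ)) ⟩
      cL ℓ                                ∎
      where
      swap : ∀ a s b → a * (s * b) ≡ s * a * b
      swap = solve-∀
    ... | no ℓ≰j = trans (cong (λ x → + x * sumUpTo j (altTerm ℓ)) (k>n⇒nCk≡0 (ℕ.≰⇒> ℓ≰j)))
                         (sym (cL-vanish ℓ (ℕ.≰⇒> ℓ≰j)))

    base-right : ∀ ℓ → coeff j cR (j ∸_) 0 ℓ ≡ cL ℓ
    base-right ℓ = begin
      coeff j cR (j ∸_) 0 ℓ                      ≡⟨ sumUpTo-cong j (cR*shiftC≡C*altTerm ℓ) ⟩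
      sumUpTo j (λ t → + (j C ℓ) * altTerm ℓ t)  ≡⟨ sumUpTo-*ˡ j (+ (j C ℓ)) (altTerm ℓ) ⟩
      + (j C ℓ) * sumUpTo j (altTerm ℓ)          ≡⟨ C*sum-altTerm≡cL ℓ ⟩
      cL ℓ                                        ∎

    coeff-left : ∀ p ℓ → sumUpTo ℓ (λ a → binom j a * binom M a * binom p (ℓ ∸ a) * sign a) ≡
                         coeff j cL (λ _ → 0) p ℓ
    coeff-left p ℓ = begin
      sumUpTo ℓ (λ a → binom j a * binom M a * binom p (ℓ ∸ a) * sign a)
        ≡⟨ sumUpTo-cong ℓ term ⟩
      sumUpTo ℓ g
        ≡⟨ sumUpTo-extend g (ℕ.m≤m+n ℓ j) beyond-ℓ ⟨
      sumUpTo (ℓ ℕ.+ j) g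
        ≡⟨ sumUpTo-extend g (ℕ.m≤n+m j ℓ) beyond-j ⟩
      sumUpTo j g ∎
      where
      g : ℕ → ℤ
      g t = cL t * + shiftC (p ℕ.+ 0) t ℓ
      beyond-ℓ : ∀ t → ℓ < t → t ≤ ℓ ℕ.+ j → g t ≡ + 0
      beyond-ℓ t ℓ<t _ = trans (cong (λ x → cL t * + x) (shiftC-> _ ℓ<t)) (ℤ.*-zeroʳ (cL t))
      beyond-j : ∀ t → j < t → t ≤ ℓ ℕ.+ j → g t ≡ + 0
      beyond-j t j<t _ = cong (_* + shiftC (p ℕ.+ 0) t ℓ) (cL-vanish t j<t)
      rotate : ∀ a b c s → a * b * c * s ≡ s * a * b * c
      rotate = solve-∀
      term : ∀ a → a ≤ ℓ → binom j a * binom M a * binom p (ℓ ∸ a) * sign a ≡ g a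
      term a a≤ℓ = trans (rotate (binom j a) (binom M a) (binom p (ℓ ∸ a)) (sign a))
        (cong (λ x → cL a * + x)
              (sym (trans (cong (λ q → shiftC q a ℓ) (ℕ.+-identityʳ p)) (shiftC-≤ p a≤ℓ))))

    coeff-right : ∀ p {m} ℓ → p ℕ.+ j ≡ m → ℓ ≤ m → coeff j cR (j ∸_) p ℓ ≡
      binom m ℓ - sumOneTo j (λ t → sign (t ∸ 1) * binom (m ∸ t) (m ∸ ℓ) * binom j t * binom (M ℕ.+ t) t)
    coeff-right p ℓ refl ℓ≤m = begin
      coeff j cR (j ∸_) p ℓ
        ≡⟨ sumUpTo-cong j (λ t t≤j → cong (λ x → cR t * + x) (complement t≤j)) ⟩
      sumUpTo j r
        ≡⟨ sumUpTo≡head+sumOneTo j r ⟩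
      r 0 + sumOneTo j r
        ≡⟨ cong₂ _+_ head (trans (sumOneTo-cong j (λ k _ → flip k)) (sumOneTo-neg j b)) ⟩
      binom (p ℕ.+ j) ℓ - sumOneTo j b
        ∎
      where
      r b : ℕ → ℤ
      r t = cR t * binom (p ℕ.+ j ∸ t) (p ℕ.+ j ∸ ℓ)
      b t = sign (t ∸ 1) * binom (p ℕ.+ j ∸ t) (p ℕ.+ j ∸ ℓ) * binom j t * binom (M ℕ.+ t) t
      complement : ∀ {t} → t ≤ j → shiftC (p ℕ.+ (j ∸ t)) t ℓ ≡ (p ℕ.+ j ∸ t) C (p ℕ.+ j ∸ ℓ)
      complement {t} t≤j = trans (cong (λ x → shiftC x t ℓ) (sym (ℕ.+-∸-assoc p t≤j)))
                             (shiftC-complement (ℕ.≤-trans t≤j (ℕ.m≤n+m j p)) ℓ≤m)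
      head : r 0 ≡ binom (p ℕ.+ j) ℓ
      head = trans (ℤ.*-identityˡ _) (cong +_ (sym (nCk≡nC[n∸k] ℓ≤m)))
      negate : ∀ s a c x → - s * a * c * x ≡ - (s * x * a * c)
      negate = solve-∀
      flip : ∀ k → r (suc k) ≡ - b (suc k)
      flip k = negate (sign k) (binom j (suc k)) (binom (M ℕ.+ suc k) (suc k)) _

  convolution-identity : ∀ p {m} ℓ → p ℕ.+ j ≡ m → ℓ ≤ m →
    sumUpTo ℓ (λ a → binom j a * binom M a * binom p (ℓ ∸ a) * sign a) ≡
    binom m ℓ - sumOneTo j (λ t → sign (t ∸ 1) * binom (m ∸ t) (m ∸ ℓ) * binom j t * binom (M ℕ.+ t) t)
  convolution-identity p ℓ p+j≡m ℓ≤m = begin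
    sumUpTo ℓ (λ a → binom j a * binom M a * binom p (ℓ ∸ a) * sign a) ≡⟨ coeff-left p ℓ ⟩
    coeff j cL (λ _ → 0) p ℓ                                          ≡⟨ same-coefficients p ℓ ⟩
    coeff j cR (j ∸_) p ℓ                                             ≡⟨ coeff-right p ℓ p+j≡m ℓ≤m ⟩
    _                                                                 ∎
    where
    same-coefficients : ∀ p ℓ → coeff j cL (λ _ → 0) p ℓ ≡ coeff j cR (j ∸_) p ℓ
    same-coefficients = pascal-unique (coeff-isPascal j cL (λ _ → 0)) (coeff-isPascal j cR (j ∸_))
                                      (λ ℓ → trans (base-left ℓ) (sym (base-right ℓ)))

A[m∸j]≡B[j] : ∀ n m ℓ {j} → j ≤ m → ℓ ≤ m → m ≤ n → A n m ℓ (m ∸ j) ≡ B n m ℓ j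
A[m∸j]≡B[j] n m ℓ {j} j≤m ℓ≤m m≤n = begin
  A n m ℓ (m ∸ j)                      ≡⟨ cong₂ (λ x y → binom m ℓ - sumUpTo ℓ (term x y))
                                                (ℕ.m∸[m∸n]≡n j≤m) (m∸[n∸o]≡m∸n+o m≤n j≤m) ⟩
  binom m ℓ - sumUpTo ℓ (term j M)     ≡⟨ cong (_-_ (binom m ℓ))
                                               (convolution-identity j M (m ∸ j) ℓ (ℕ.m∸n+n≡m j≤m) ℓ≤m) ⟩
  binom m ℓ - (binom m ℓ - B n m ℓ j)  ≡⟨ x-[x-y]≡y (binom m ℓ) (B n m ℓ j) ⟩
  B n m ℓ j                            ∎
  where
  M = n ∸ m ℕ.+ j
  term : ℕ → ℕ → ℕ → ℤ
  term x y a = binom x a * binom y a * binom (m ∸ j) (ℓ ∸ a) * sign a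
  x-[x-y]≡y : ∀ x y → x - (x - y) ≡ y
  x-[x-y]≡y = solve-∀

corollary4p4 : (n m ℓ : ℕ) → 1 ≤ ℓ → ℓ ≤ m → m ≤ n →
    ((∀ i → i < m → ¬ (A n m ℓ i ≡ + 0)) ⇔ (∀ j → 1 ≤ j → j ≤ m → ¬ (B n m ℓ j ≡ + 0)))
corollary4p4 n m ℓ _ ℓ≤m m≤n = mk⇔
  (λ A≢0 j 1≤j j≤m B≡0 →
    A≢0 (m ∸ j) (ℕ.∸-monoʳ-< 1≤j j≤m) (trans (A[m∸j]≡B[j] n m ℓ j≤m ℓ≤m m≤n) B≡0))
  (λ B≢0 i i<m A≡0 → let m∸i≤m = ℕ.m∸n≤m m i in
    B≢0 (m ∸ i) (ℕ.m<n⇒0<n∸m i<m) m∸i≤m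
        (begin
          B n m ℓ (m ∸ i)       ≡⟨ A[m∸j]≡B[j] n m ℓ m∸i≤m ℓ≤m m≤n ⟨
          A n m ℓ (m ∸ (m ∸ i)) ≡⟨ cong (A n m ℓ) (ℕ.m∸[m∸n]≡n (ℕ.<⇒≤ i<m)) ⟩
          A n m ℓ i             ≡⟨ A≡0 ⟩
          + 0                   ∎))
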